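{- Let $G_0,G_1,\dots$ be graphs and $H_0\subseteq H_1\subseteq\cdots$ graphs with $H_n\subseteq G_n$ for all $n$, and suppose there are minor-maps $\varphi_n\colon G_n\succcurlyeq G_{n+1}$ that restrict to the identity on $H_n$. Then $\bigcup_{n\in\mathbb N}H_n$ is a minor of $G_0$.
   Context: Graphs are simple and may be infinite. A minor-map $\varphi\colon G\succcurlyeq H$ is a pair $(U,f)$ with $U\subseteq V(G)$ and $f\colon U\to V(H)$ surjective such that the preimages $f^{ -1}(x)$, $x\in V(H)$, form the branch sets of a model of $H$ in $G$: each $f^{ -1}(x)$ induces a connected subgraph of $G$, and $G$ has an $f^{ -1}(x)$–$f^{ -1}(y)$ edge whenever $xy\in E(H)$. $\varphi_n$ restricts to the identity on $H_n$ means $V(H_n)\subseteq U$ and $f(x)=x$ for all $x\in V(H_n)$ (here $H_n\subseteq H_{n+1}\subseteq G_{n+1}$). $H$ is a minor of $G$ if there is a minor-map $G\succcurlyeq H$. -}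

module Defs where

open import Data.Nat using (ℕ)
open import Data.Product using (Σ; ∃; _×_; _,_; proj₁; proj₂)
open import Relation.Nullary using (¬_)
open import Relation.Binary.PropositionalEquality using (_≡_)

-- Graphs are (possibly infinite) simple graphs whose vertices lie in a
-- common ambient universe X (as in set theory, where ⋃ Hₙ makes sense).
record Graph (X : Set) : Set₁ where
  field
    V     : X → Set
    E     : X → X → Set
    E-sym : ∀ {x y} → E x y → E y x
    E-irr : ∀ {x} → ¬ E x x
    E-V   : ∀ {x y} → E x y → V x × V y
open Graph public

record _⊆G_ {X : Set} (H G : Graph X) : Set where
  field
    ⊆V : ∀ {x} → V H x → V G x
    ⊆E : ∀ {x y} → E H x y → E G x y
open _⊆G_ public

⋃G : {X : Set} → (ℕ → Graph X) → Graph X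
⋃G {X} H = record
  { V = λ x → Σ ℕ λ n → V (H n) x
  ; E = λ x y → Σ ℕ λ n → E (H n) x y
  ; E-sym = λ { (n , e) → n , E-sym (H n) e }
  ; E-irr = λ { (n , e) → E-irr (H n) e }
  ; E-V = λ { (n , e) → (n , proj₁ (E-V (H n) e)) , (n , proj₂ (E-V (H n) e)) }
  }

data WalkIn {X : Set} (G : Graph X) (P : X → Set) : X → X → Set where
  here : ∀ {x} → P x → WalkIn G P x x
  step : ∀ {x z w} → P x → E G x z → WalkIn G P z w → WalkIn G P x w

-- A minor-map φ = (U , f) : G ≽ H.  The partial function f : U → V(H) is
-- given by its graph F : F x y  means  x ∈ U and f x = y.
record MinorMap {X : Set} (G H : Graph X) : Set₁ where
  field
    F          : X → X → Set
    functional : ∀ {x y y'} → F x y → F x y' → y ≡ y'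
    dom⊆V      : ∀ {x y} → F x y → V G x
    cod⊆V      : ∀ {x y} → F x y → V H y
    surjective : ∀ {y} → V H y → ∃ λ x → F x y
    connected  : ∀ {x x' y} → F x y → F x' y → WalkIn G (λ z → F z y) x x'
    edges      : ∀ {y y'} → E H y y' →
                 Σ X λ x → Σ X λ x' → F x y × F x' y' × E G x x'
open MinorMap public

IdentityOn : {X : Set} {G G' : Graph X} → MinorMap G G' → Graph X → Set
IdentityOn {X} φ H = ∀ {x} → V H x → F φ x x

IsMinor : {X : Set} → Graph X → Graph X → Set₁
IsMinor H G = MinorMap G H

module Submission where

open import Defs
open import Data.Nat using (ℕ; suc; zero; _⊔_; _≤′_; ≤′-refl; ≤′-step)
open import Data.Nat.Properties using (m≤m⊔n; m≤n⊔m; ≤⇒≤′)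
open import Data.Product using (Σ; ∃; _×_; _,_; proj₁; proj₂)
open import Relation.Binary.PropositionalEquality using (_≡_; refl)

-- The composites φ₀ ∘ ⋯ ∘ φₙ₋₁ : G₀ ≽ Gₙ fix every vertex of Hₙ from the
-- stage where it appears on, so a vertex x of ⋃ Hₙ has a well-defined
-- branch set in G₀: its branch set under any composite whose target
-- already contains x in Hₙ.

module _ {X : Set} {G : Graph X} where

  walk-map : {P Q : X → Set} → (∀ {z} → P z → Q z) →
             ∀ {x y} → WalkIn G P x y → WalkIn G Q x y
  walk-map f (here p)     = here (f p)
  walk-map f (step p e w) = step (f p) e (walk-map f w)

  walk-append : {P : X → Set} {x y z w : X} →
                WalkIn G P x y → E G y z → WalkIn G P z w → WalkIn G P x w
  walk-append (here p)      e w₂ = step p e w₂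
  walk-append (step p e′ w) e w₂ = step p e′ (walk-append w e w₂)

minorMap-id : {X : Set} (G : Graph X) → MinorMap G G
F          (minorMap-id G) x y = (x ≡ y) × V G x
functional (minorMap-id G) (refl , _) (refl , _) = refl
dom⊆V      (minorMap-id G) (_ , v) = v
cod⊆V      (minorMap-id G) (refl , v) = v
surjective (minorMap-id G) {y} v = y , refl , v
connected  (minorMap-id G) (refl , v) (refl , _) = here (refl , v)
edges      (minorMap-id G) e =
  _ , _ , (refl , proj₁ (E-V G e)) , (refl , proj₂ (E-V G e)) , e

minorMap-∘ : {X : Set} {G H K : Graph X} →
             MinorMap H K → MinorMap G H → MinorMap G K
minorMap-∘ {X} {G} {H} {K} ψ φ = record
  { F          = F∘
  ; functional = functional∘
  ; dom⊆V      = λ (_ , p , _) → dom⊆V φ p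
  ; cod⊆V      = λ (_ , _ , f) → cod⊆V ψ f
  ; surjective = surjective∘
  ; connected  = λ (_ , p , f) (_ , p′ , f′) → lift-walk (connected ψ f f′) p p′
  ; edges      = edges∘
  }
  where
  F∘ : X → X → Set
  F∘ z y = Σ X λ w → F φ z w × F ψ w y

  functional∘ : ∀ {z y y′} → F∘ z y → F∘ z y′ → y ≡ y′
  functional∘ (_ , p , f) (_ , p′ , f′) with functional φ p p′
  ... | refl = functional ψ f f′

  surjective∘ : ∀ {y} → V K y → ∃ λ z → F∘ z y
  surjective∘ v with surjective ψ v
  ... | w , f with surjective φ (dom⊆V ψ f)
  ... | z , p = z , w , p , f

  edges∘ : ∀ {y y′} → E K y y′ → Σ X λ a → Σ X λ b → F∘ a y × F∘ b y′ × E G a b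
  edges∘ e with edges ψ e
  ... | w , w′ , f , f′ , e′ with edges φ e′
  ... | a , b , p , p′ , e₀ = a , b , (w , p , f) , (w′ , p′ , f′) , e₀

  -- Each vertex of a walk in H becomes a connected branch set of φ, and each
  -- edge of the walk an edge of G between consecutive branch sets.
  lift-walk : ∀ {y w w′ z z′} → WalkIn H (λ a → F ψ a y) w w′ →
              F φ z w → F φ z′ w′ → WalkIn G (λ a → F∘ a y) z z′
  lift-walk {w = w} (here f) p p′ = walk-map (λ q → w , q , f) (connected φ p p′)
  lift-walk {w = w} (step f e W) p p′ with edges φ e
  ... | a , b , pa , pb , e₀ =
    walk-append (walk-map (λ q → w , q , f) (connected φ p pa)) e₀ (lift-walk W pb p′)

⊆G-≤′ : {X : Set} (H : ℕ → Graph X) → (∀ n → H n ⊆G H (suc n)) →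
        ∀ {m n} → m ≤′ n → ∀ {x} → V (H m) x → V (H n) x
⊆G-≤′ H H⊆ ≤′-refl       h = h
⊆G-≤′ H H⊆ (≤′-step m≤n) h = ⊆V (H⊆ _) (⊆G-≤′ H H⊆ m≤n h)

⋃-isMinor : {X : Set} (G : Graph X) (K H : ℕ → Graph X) →
            (∀ n → H n ⊆G H (suc n)) →
            (∀ n → H n ⊆G K n) →
            (ψ : ∀ n → MinorMap G (K n)) →
            (∀ n {z x} → F (ψ n) z x → V (H n) x → F (ψ (suc n)) z x) →
            IsMinor (⋃G H) G
⋃-isMinor {X} G K H H⊆ H⊆K ψ stable = record
  { F          = F⋃
  ; functional = λ p p′ → let (n , q , q′ , _) = at-common-stage p p′ in functional (ψ n) q q′
  ; dom⊆V      = λ (m , _ , p) → dom⊆V (ψ m) p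
  ; cod⊆V      = λ (m , h , _) → m , h
  ; surjective = surjective⋃
  ; connected  = connected⋃
  ; edges      = edges⋃
  }
  where
  F⋃ : X → X → Set
  F⋃ z x = Σ ℕ λ m → V (H m) x × F (ψ m) z x

  stable-≤′ : ∀ {m n} → m ≤′ n → ∀ {z x} → F (ψ m) z x → V (H m) x → F (ψ n) z x
  stable-≤′ ≤′-refl       p h = p
  stable-≤′ (≤′-step m≤n) p h = stable _ (stable-≤′ m≤n p h) (⊆G-≤′ H H⊆ m≤n h)

  at-common-stage : ∀ {z z′ x x′} → F⋃ z x → F⋃ z′ x′ →
                    Σ ℕ λ n → F (ψ n) z x × F (ψ n) z′ x′ × V (H n) x
  at-common-stage (m , h , p) (m′ , h′ , p′) =
    m ⊔ m′ , stable-≤′ m≤ p h , stable-≤′ m′≤ p′ h′ , ⊆G-≤′ H H⊆ m≤ h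
    where
    m≤  = ≤⇒≤′ (m≤m⊔n m m′)
    m′≤ = ≤⇒≤′ (m≤n⊔m m m′)

  surjective⋃ : ∀ {x} → V (⋃G H) x → ∃ λ z → F⋃ z x
  surjective⋃ (m , h) with surjective (ψ m) (⊆V (H⊆K m) h)
  ... | z , p = z , m , h , p

  connected⋃ : ∀ {z z′ x} → F⋃ z x → F⋃ z′ x → WalkIn G (λ a → F⋃ a x) z z′
  connected⋃ p p′ with at-common-stage p p′
  ... | n , q , q′ , h = walk-map (λ r → n , h , r) (connected (ψ n) q q′)

  edges⋃ : ∀ {x y} → E (⋃G H) x y → Σ X λ a → Σ X λ b → F⋃ a x × F⋃ b y × E G a b
  edges⋃ (m , e) with edges (ψ m) (⊆E (H⊆K m) e)
  ... | a , b , p , p′ , e₀ =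
    a , b , (m , proj₁ (E-V (H m) e) , p) , (m , proj₂ (E-V (H m) e) , p′) , e₀

lemma5p12 : {X : Set} (G H : ℕ → Graph X) →
            (∀ n → H n ⊆G H (suc n)) →
            (∀ n → H n ⊆G G n) →
            (φ : ∀ n → MinorMap (G n) (G (suc n))) →
            (∀ n → IdentityOn (φ n) (H n)) →
            IsMinor (⋃G H) (G 0)
lemma5p12 G H H⊆ H⊆G φ φ-id = ⋃-isMinor (G 0) G H H⊆ H⊆G Φ Φ-stable
  where
  Φ : ∀ n → MinorMap (G 0) (G n)
  Φ zero    = minorMap-id (G 0)
  Φ (suc n) = minorMap-∘ (φ n) (Φ n)

  Φ-stable : ∀ n {z x} → F (Φ n) z x → V (H n) x → F (Φ (suc n)) z x
  Φ-stable n p h = _ , p , φ-id n h
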